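{- For each odd integer $n\ge 3$ there exists a saturated pure partial plane of order $n$ in which no point lies on more than $2$ lines.
   Context: A pure partial plane of order $n$ and size $s$ is a set $X$ of $n^2+n+1$ points together with a collection of $s$ distinct lines, each line being a subset of $X$ of cardinality $n+1$, such that any two distinct lines intersect in exactly one point. It is saturated if no $(n+1)$-subset of $X$ other than the existing lines meets every existing line in exactly one point (so no line can be added keeping it a pure partial plane). -}

module Defs where

open import Data.Nat using (ℕ; suc; _+_; _*_; _≤_)
open import Data.Fin using (Fin)
open import Data.Fin.Subset using (Subset; _∩_; ∣_∣; _∈_)
open import Data.Fin.Subset.Properties using (_∈?_)
open import Data.List using (List; length; filter)
open import Data.List.Relation.Unary.Unique.Propositional using (Unique)
open import Data.List.Relation.Unary.All using (All)
import Data.List.Membership.Propositional as LM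
open import Relation.Binary.PropositionalEquality using (_≡_; _≢_)
open import Relation.Nullary using (¬_)

numPoints : ℕ → ℕ
numPoints n = n * n + n + 1

Line : ℕ → Set
Line n = Subset (numPoints n)

record PurePartialPlane (n : ℕ) : Set where
  field
    lines      : List (Line n)
    distinct   : Unique lines
    lineSize   : All (λ L → ∣ L ∣ ≡ suc n) lines
    intersect1 : ∀ {L M} → L LM.∈ lines → M LM.∈ lines → L ≢ M → ∣ L ∩ M ∣ ≡ 1
open PurePartialPlane public

size : ∀ {n} → PurePartialPlane n → ℕ
size P = length (lines P)

Saturated : ∀ {n} → PurePartialPlane n → Set
Saturated {n} P =
  (S : Line n) → ∣ S ∣ ≡ suc n →
  All (λ L → ∣ S ∩ L ∣ ≡ 1) (lines P) → S LM.∈ lines P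

degree : ∀ {n} → PurePartialPlane n → Fin (numPoints n) → ℕ
degree P x = length (filter (x ∈?_) (lines P))

-- Take the dual of the complete graph K_{n+2}: its points are the edges, its lines the
-- n+2 vertex stars, padded with isolated points up to n²+n+1 points. Two stars share
-- exactly one edge and every edge lies in exactly two stars, so this is a pure partial
-- plane with all degrees ≤ 2. A further line would have to meet every star exactly once,
-- i.e. contain a perfect matching of K_{n+2}; by the handshake lemma the number of stars
-- is then even, which is impossible when n is odd. So the plane is saturated.
module Submission where

open import Defs
open import Data.Nat using (ℕ; zero; suc; _+_; _*_; _≤_; parity)
open import Data.Nat.Properties
  using (module ≤-Reasoning; +-identityʳ; m≤m+n; *-monoʳ-≤; m+1+n≢0; suc-injective;
         +-0-commutativeMonoid)
open import Data.Nat.Tactic.RingSolver using (solve-∀)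
open import Data.Parity.Base using (0ℙ; 1ℙ) renaming (_+_ to _ℙ+_)
import Data.Parity.Properties as ℙ
open import Data.Bool using (true; false)
open import Data.Fin using (Fin; zero; suc)
import Data.Fin.Properties as Fin
open import Data.Fin.Subset using (Subset; _∩_; ∣_∣; _∈_; _∉_; ⊤; ⊥; ⁅_⁆)
open import Data.Fin.Subset.Properties
  using (_∈?_; ∣⊥∣≡0; ∣⊤∣≡n; ∣⁅x⁆∣≡1; ∩-idem; ∩-comm; ∩-identityˡ; ∩-identityʳ; ∩-zeroˡ; ∩-zeroʳ)
open import Data.Vec using (_∷_; []; _++_; take; drop; here; there)
open import Data.Vec.Properties using (zipWith-++; take++drop≡id)
open import Data.List using (length; filter; tabulate)
import Data.List.Relation.Unary.All.Properties as All
import Data.List.Relation.Unary.Unique.Propositional.Properties as Unique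
import Data.List.Membership.Propositional as LM
open import Data.List.Membership.Propositional.Properties using (∈-tabulate⁻)
open import Data.Product using (Σ; _×_; _,_)
open import Algebra.Properties.CommutativeMonoid.Sum +-0-commutativeMonoid
  using (sum; sum-syntax; sum-cong-≗; ∑-distrib-+)
open import Relation.Binary.PropositionalEquality
open import Function using (_∘_)
open import Relation.Nullary using (¬_; yes; no; contradiction)

private
  variable
    a b N : ℕ

∣p++q∣≡∣p∣+∣q∣ : (p : Subset a) (q : Subset b) → ∣ p ++ q ∣ ≡ ∣ p ∣ + ∣ q ∣
∣p++q∣≡∣p∣+∣q∣ []          q = refl
∣p++q∣≡∣p∣+∣q∣ (true ∷ p)  q = cong suc (∣p++q∣≡∣p∣+∣q∣ p q)
∣p++q∣≡∣p∣+∣q∣ (false ∷ p) q = ∣p++q∣≡∣p∣+∣q∣ p q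

∣p++q∩r++s∣≡∣p∩r∣+∣q∩s∣ : (p r : Subset a) (q s : Subset b) →
                          ∣ (p ++ q) ∩ (r ++ s) ∣ ≡ ∣ p ∩ r ∣ + ∣ q ∩ s ∣
∣p++q∩r++s∣≡∣p∩r∣+∣q∩s∣ p r q s =
  trans (cong ∣_∣ (zipWith-++ _ p q r s)) (∣p++q∣≡∣p∣+∣q∣ (p ∩ r) (q ∩ s))

∣p∩⊥∣≡0 : (p : Subset a) → ∣ p ∩ ⊥ ∣ ≡ 0
∣p∩⊥∣≡0 {a} p = trans (cong ∣_∣ (∩-zeroʳ p)) (∣⊥∣≡0 a)

∣⊥∩p∣≡0 : (p : Subset a) → ∣ ⊥ ∩ p ∣ ≡ 0
∣⊥∩p∣≡0 {a} p = trans (cong ∣_∣ (∩-zeroˡ p)) (∣⊥∣≡0 a)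

x≢y⇒∣⁅x⁆∩⁅y⁆∣≡0 : {x y : Fin a} → x ≢ y → ∣ ⁅ x ⁆ ∩ ⁅ y ⁆ ∣ ≡ 0
x≢y⇒∣⁅x⁆∩⁅y⁆∣≡0 {x = zero}  {zero}  x≢y = contradiction refl x≢y
x≢y⇒∣⁅x⁆∩⁅y⁆∣≡0 {x = zero}  {suc y} x≢y = ∣⊥∩p∣≡0 ⁅ y ⁆
x≢y⇒∣⁅x⁆∩⁅y⁆∣≡0 {x = suc x} {zero}  x≢y = ∣p∩⊥∣≡0 ⁅ x ⁆
x≢y⇒∣⁅x⁆∩⁅y⁆∣≡0 {x = suc x} {suc y} x≢y = x≢y⇒∣⁅x⁆∩⁅y⁆∣≡0 (x≢y ∘ cong suc)

x∈p⇒∣⁅x⁆∩p∣≡1 : {x : Fin a} {p : Subset a} → x ∈ p → ∣ ⁅ x ⁆ ∩ p ∣ ≡ 1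
x∈p⇒∣⁅x⁆∩p∣≡1 {p = _ ∷ p} here      = cong suc (∣⊥∩p∣≡0 p)
x∈p⇒∣⁅x⁆∩p∣≡1             (there x∈p) = x∈p⇒∣⁅x⁆∩p∣≡1 x∈p

x∉p⇒∣⁅x⁆∩p∣≡0 : {x : Fin a} {p : Subset a} → x ∉ p → ∣ ⁅ x ⁆ ∩ p ∣ ≡ 0
x∉p⇒∣⁅x⁆∩p∣≡0 {x = zero}  {true ∷ p}  x∉p = contradiction here x∉p
x∉p⇒∣⁅x⁆∩p∣≡0 {x = zero}  {false ∷ p} x∉p = ∣⊥∩p∣≡0 p
x∉p⇒∣⁅x⁆∩p∣≡0 {x = suc x} {_ ∷ p}     x∉p = x∉p⇒∣⁅x⁆∩p∣≡0 (λ x∈p → x∉p (there x∈p))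

∑∣p∩⁅i⁆∣≡∣p∣ : (p : Subset a) → ∑[ i < a ] ∣ p ∩ ⁅ i ⁆ ∣ ≡ ∣ p ∣
∑∣p∩⁅i⁆∣≡∣p∣ []          = refl
∑∣p∩⁅i⁆∣≡∣p∣ (true ∷ p)  = cong₂ (λ x y → suc (x + y)) (∣p∩⊥∣≡0 p) (∑∣p∩⁅i⁆∣≡∣p∣ p)
∑∣p∩⁅i⁆∣≡∣p∣ (false ∷ p) = cong₂ _+_ (∣p∩⊥∣≡0 p) (∑∣p∩⁅i⁆∣≡∣p∣ p)

∑-const-1 : (f : Fin a → ℕ) → (∀ i → f i ≡ 1) → sum f ≡ a
∑-const-1 {zero}  f f≡1 = refl
∑-const-1 {suc a} f f≡1 = cong₂ _+_ (f≡1 zero) (∑-const-1 (λ i → f (suc i)) (λ i → f≡1 (suc i)))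

length-filter-∈-tabulate : (x : Fin N) (f : Fin a → Subset N) →
                           length (filter (x ∈?_) (tabulate f)) ≡ ∑[ i < a ] ∣ ⁅ x ⁆ ∩ f i ∣
length-filter-∈-tabulate {a = zero}  x f = refl
length-filter-∈-tabulate {a = suc a} x f with x ∈? f zero
... | yes x∈f0 rewrite x∈p⇒∣⁅x⁆∩p∣≡1 x∈f0 = cong suc (length-filter-∈-tabulate x (λ i → f (suc i)))
... | no  x∉f0 rewrite x∉p⇒∣⁅x⁆∩p∣≡0 x∉f0 = length-filter-∈-tabulate x (λ i → f (suc i))

2*m≢odd : ∀ m {n} → parity n ≡ 1ℙ → 2 * m ≢ n
2*m≢odd m odd eq = ℙ.p≢p⁻¹ 0ℙ (begin
  0ℙ              ≡⟨ ℙ.*-homo-* 2 m ⟨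
  parity (2 * m)  ≡⟨ cong parity eq ⟩
  _               ≡⟨ odd ⟩
  1ℙ              ∎)
  where open ≡-Reasoning

parity[2*k+1]≡1ℙ : ∀ k → parity (2 * k + 1) ≡ 1ℙ
parity[2*k+1]≡1ℙ k = begin
  parity (2 * k + 1)      ≡⟨ ℙ.+-homo-+ (2 * k) 1 ⟩
  parity (2 * k) ℙ+ 1ℙ    ≡⟨ cong (_ℙ+ 1ℙ) (ℙ.*-homo-* 2 k) ⟩
  1ℙ                      ∎
  where open ≡-Reasoning

triangular : ℕ → ℕ
triangular zero    = 0
triangular (suc m) = m + triangular m

-- Points are the edges of K_m, listed for K_{1+m} as the m edges at vertex 0 followed by
-- the edges of K_m on the remaining vertices; star m i is the set of edges at vertex i.
star : (m : ℕ) → Fin m → Subset (triangular m)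
star (suc m) zero    = ⊤ {m} ++ ⊥ {triangular m}
star (suc m) (suc i) = ⁅ i ⁆ ++ star m i

∣star∣≡m : ∀ m (i : Fin (suc m)) → ∣ star (suc m) i ∣ ≡ m
∣star∣≡m m zero = begin
  ∣ star (suc m) zero ∣              ≡⟨ ∣p++q∣≡∣p∣+∣q∣ (⊤ {m}) ⊥ ⟩
  ∣ ⊤ {m} ∣ + ∣ ⊥ {triangular m} ∣  ≡⟨ cong₂ _+_ (∣⊤∣≡n m) (∣⊥∣≡0 (triangular m)) ⟩
  m + 0                             ≡⟨ +-identityʳ m ⟩
  m                                 ∎
  where open ≡-Reasoning
∣star∣≡m (suc m) (suc i) =
  trans (∣p++q∣≡∣p∣+∣q∣ ⁅ i ⁆ (star (suc m) i)) (cong₂ _+_ (∣⁅x⁆∣≡1 i) (∣star∣≡m m i))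

∣star∩star∣≡1 : ∀ m {i j : Fin m} → i ≢ j → ∣ star m i ∩ star m j ∣ ≡ 1
∣star∩star∣≡1 (suc m) {zero}  {zero}  i≢j = contradiction refl i≢j
∣star∩star∣≡1 (suc m) {zero}  {suc j} _   = begin
  ∣ star (suc m) zero ∩ star (suc m) (suc j) ∣
    ≡⟨ ∣p++q∩r++s∣≡∣p∩r∣+∣q∩s∣ (⊤ {m}) ⁅ j ⁆ ⊥ (star m j) ⟩
  ∣ ⊤ ∩ ⁅ j ⁆ ∣ + ∣ ⊥ ∩ star m j ∣
    ≡⟨ cong₂ _+_ (cong ∣_∣ (∩-identityˡ ⁅ j ⁆)) (∣⊥∩p∣≡0 (star m j)) ⟩
  ∣ ⁅ j ⁆ ∣ + 0
    ≡⟨ cong (_+ 0) (∣⁅x⁆∣≡1 j) ⟩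
  1
    ∎
  where open ≡-Reasoning
∣star∩star∣≡1 (suc m) {suc i} {zero}  i≢j =
  trans (cong ∣_∣ (∩-comm (star (suc m) (suc i)) (star (suc m) zero)))
        (∣star∩star∣≡1 (suc m) (i≢j ∘ sym))
∣star∩star∣≡1 (suc m) {suc i} {suc j} i≢j = begin
  ∣ (⁅ i ⁆ ++ star m i) ∩ (⁅ j ⁆ ++ star m j) ∣
    ≡⟨ ∣p++q∩r++s∣≡∣p∩r∣+∣q∩s∣ ⁅ i ⁆ ⁅ j ⁆ (star m i) (star m j) ⟩
  ∣ ⁅ i ⁆ ∩ ⁅ j ⁆ ∣ + ∣ star m i ∩ star m j ∣
    ≡⟨ cong₂ _+_ (x≢y⇒∣⁅x⁆∩⁅y⁆∣≡0 i≢j′) (∣star∩star∣≡1 m i≢j′) ⟩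
  1
    ∎
  where
  open ≡-Reasoning
  i≢j′ : i ≢ j
  i≢j′ = i≢j ∘ cong suc

handshake : ∀ m (p : Subset (triangular m)) → ∑[ i < m ] ∣ p ∩ star m i ∣ ≡ 2 * ∣ p ∣
handshake zero    []  = refl
handshake (suc m) p   = subst (λ p → ∑[ i < suc m ] ∣ p ∩ star (suc m) i ∣ ≡ 2 * ∣ p ∣)
                              (take++drop≡id m p) (split (take m p) (drop m p))
  where
  open ≡-Reasoning
  regroup : ∀ x y → (x + 0) + (x + 2 * y) ≡ 2 * (x + y)
  regroup = solve-∀
  split : (q : Subset m) (r : Subset (triangular m)) →
          ∑[ i < suc m ] ∣ (q ++ r) ∩ star (suc m) i ∣ ≡ 2 * ∣ q ++ r ∣
  split q r = begin
    ∣ (q ++ r) ∩ star (suc m) zero ∣ + ∑[ i < m ] ∣ (q ++ r) ∩ (⁅ i ⁆ ++ star m i) ∣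
      ≡⟨ cong₂ _+_ (∣p++q∩r++s∣≡∣p∩r∣+∣q∩s∣ q ⊤ r ⊥)
                   (sum-cong-≗ (λ i → ∣p++q∩r++s∣≡∣p∩r∣+∣q∩s∣ q ⁅ i ⁆ r (star m i))) ⟩
    (∣ q ∩ ⊤ ∣ + ∣ r ∩ ⊥ ∣) + ∑[ i < m ] (∣ q ∩ ⁅ i ⁆ ∣ + ∣ r ∩ star m i ∣)
      ≡⟨ cong₂ _+_ (cong₂ _+_ (cong ∣_∣ (∩-identityʳ q)) (∣p∩⊥∣≡0 r))
                   (∑-distrib-+ (λ i → ∣ q ∩ ⁅ i ⁆ ∣) (λ i → ∣ r ∩ star m i ∣)) ⟩
    (∣ q ∣ + 0) + (∑[ i < m ] ∣ q ∩ ⁅ i ⁆ ∣ + ∑[ i < m ] ∣ r ∩ star m i ∣)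
      ≡⟨ cong ((∣ q ∣ + 0) +_) (cong₂ _+_ (∑∣p∩⁅i⁆∣≡∣p∣ q) (handshake m r)) ⟩
    (∣ q ∣ + 0) + (∣ q ∣ + 2 * ∣ r ∣)
      ≡⟨ regroup ∣ q ∣ ∣ r ∣ ⟩
    2 * (∣ q ∣ + ∣ r ∣)
      ≡⟨ cong (2 *_) (∣p++q∣≡∣p∣+∣q∣ q r) ⟨
    2 * ∣ q ++ r ∣
      ∎

module Padding (a r : ℕ) where

  embed : a + r ≡ N → Subset a → Subset N
  embed eq p = subst Subset eq (p ++ ⊥)

  restrict : a + r ≡ N → Subset N → Subset a
  restrict eq S = take a (subst Subset (sym eq) S)

  ∣embed∣ : (eq : a + r ≡ N) (p : Subset a) → ∣ embed eq p ∣ ≡ ∣ p ∣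
  ∣embed∣ refl p =
    trans (∣p++q∣≡∣p∣+∣q∣ p (⊥ {r})) (trans (cong (∣ p ∣ +_) (∣⊥∣≡0 r)) (+-identityʳ ∣ p ∣))

  ∣embed∩embed∣ : (eq : a + r ≡ N) (p q : Subset a) → ∣ embed eq p ∩ embed eq q ∣ ≡ ∣ p ∩ q ∣
  ∣embed∩embed∣ refl p q =
    trans (∣p++q∩r++s∣≡∣p∩r∣+∣q∩s∣ p q ⊥ ⊥)
          (trans (cong (∣ p ∩ q ∣ +_) (∣p∩⊥∣≡0 (⊥ {r}))) (+-identityʳ _))

  ∣S∩embed∣ : (eq : a + r ≡ N) (S : Subset N) (p : Subset a) →
              ∣ S ∩ embed eq p ∣ ≡ ∣ restrict eq S ∩ p ∣
  ∣S∩embed∣ refl S p = begin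
    ∣ S ∩ (p ++ ⊥) ∣                       ≡⟨ cong (λ S → ∣ S ∩ (p ++ ⊥) ∣) (take++drop≡id a S) ⟨
    ∣ (take a S ++ drop a S) ∩ (p ++ ⊥) ∣  ≡⟨ ∣p++q∩r++s∣≡∣p∩r∣+∣q∩s∣ (take a S) p (drop a S) ⊥ ⟩
    ∣ take a S ∩ p ∣ + ∣ drop a S ∩ ⊥ ∣    ≡⟨ cong (∣ take a S ∩ p ∣ +_) (∣p∩⊥∣≡0 (drop a S)) ⟩
    ∣ take a S ∩ p ∣ + 0                   ≡⟨ +-identityʳ _ ⟩
    ∣ take a S ∩ p ∣                       ∎
    where open ≡-Reasoning

  ∣restrict∣≤∣S∣ : (eq : a + r ≡ N) (S : Subset N) → ∣ restrict eq S ∣ ≤ ∣ S ∣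
  ∣restrict∣≤∣S∣ refl S = begin
    ∣ take a S ∣                 ≤⟨ m≤m+n _ _ ⟩
    ∣ take a S ∣ + ∣ drop a S ∣  ≡⟨ ∣p++q∣≡∣p∣+∣q∣ (take a S) (drop a S) ⟨
    ∣ take a S ++ drop a S ∣     ≡⟨ cong ∣_∣ (take++drop≡id a S) ⟩
    ∣ S ∣                        ∎
    where open ≤-Reasoning

module FamilyPlane {n m : ℕ} (f : Fin m → Line n) (n≢0 : n ≢ 0)
                   (∣f∣≡1+n : ∀ i → ∣ f i ∣ ≡ suc n)
                   (∣f∩f∣≡1 : ∀ {i j} → i ≢ j → ∣ f i ∩ f j ∣ ≡ 1) where

  f-injective : ∀ {i j} → f i ≡ f j → i ≡ j
  f-injective {i} {j} fi≡fj with i Fin.≟ j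
  ... | yes i≡j = i≡j
  ... | no  i≢j = contradiction (suc-injective 1+n≡1) n≢0
    where
    1+n≡1 : suc n ≡ 1
    1+n≡1 = begin
      suc n            ≡⟨ ∣f∣≡1+n j ⟨
      ∣ f j ∣          ≡⟨ cong ∣_∣ (∩-idem (f j)) ⟨
      ∣ f j ∩ f j ∣    ≡⟨ cong (λ L → ∣ L ∩ f j ∣) fi≡fj ⟨
      ∣ f i ∩ f j ∣    ≡⟨ ∣f∩f∣≡1 i≢j ⟩
      1                ∎
      where open ≡-Reasoning

  plane : PurePartialPlane n
  plane = record
    { lines      = tabulate f
    ; distinct   = Unique.tabulate⁺ f-injective
    ; lineSize   = All.tabulate⁺ ∣f∣≡1+n
    ; intersect1 = meet
    }
    where
    meet : ∀ {L M} → L LM.∈ tabulate f → M LM.∈ tabulate f → L ≢ M → ∣ L ∩ M ∣ ≡ 1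
    meet L∈ M∈ L≢M with ∈-tabulate⁻ L∈ | ∈-tabulate⁻ M∈
    ... | i , refl | j , refl = ∣f∩f∣≡1 (L≢M ∘ cong f)

  degree-plane : ∀ x → degree plane x ≡ ∑[ i < m ] ∣ ⁅ x ⁆ ∩ f i ∣
  degree-plane x = length-filter-∈-tabulate x f

  no-transversal⇒saturated : (∀ S → ¬ (∀ i → ∣ S ∩ f i ∣ ≡ 1)) → Saturated plane
  no-transversal⇒saturated no-transversal S _ S∩f≡1 =
    contradiction (All.tabulate⁻ S∩f≡1) (no-transversal S)

2*triangular[j]+j≡j*j : ∀ j → 2 * triangular j + j ≡ j * j
2*triangular[j]+j≡j*j zero    = refl
2*triangular[j]+j≡j*j (suc j) = begin
  2 * (j + t) + suc j        ≡⟨ regroup j t ⟩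
  (2 * t + j) + (1 + 2 * j)  ≡⟨ cong (_+ (1 + 2 * j)) (2*triangular[j]+j≡j*j j) ⟩
  j * j + (1 + 2 * j)        ≡⟨ square-suc j ⟩
  suc j * suc j              ∎
  where
  open ≡-Reasoning
  t = triangular j
  regroup : ∀ j t → 2 * (j + t) + suc j ≡ (2 * t + j) + (1 + 2 * j)
  regroup = solve-∀
  square-suc : ∀ j → j * j + (1 + 2 * j) ≡ suc j * suc j
  square-suc = solve-∀

-- The n+2 stars use the C(n+2,2) edges; the remaining C(n,2) points stay on no line.
triangular[2+n]+triangular[n]≡numPoints : ∀ n → triangular (2 + n) + triangular n ≡ numPoints n
triangular[2+n]+triangular[n]≡numPoints n = begin
  suc n + (n + t) + t  ≡⟨ regroup n t ⟩
  (2 * t + n) + n + 1  ≡⟨ cong (λ s → s + n + 1) (2*triangular[j]+j≡j*j n) ⟩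
  n * n + n + 1        ∎
  where
  open ≡-Reasoning
  t = triangular n
  regroup : ∀ n t → suc n + (n + t) + t ≡ (2 * t + n) + n + 1
  regroup = solve-∀

module StarPlane (n : ℕ) where
  open Padding (triangular (2 + n)) (triangular n)

  points : triangular (2 + n) + triangular n ≡ numPoints n
  points = triangular[2+n]+triangular[n]≡numPoints n

  starLine : Fin (2 + n) → Line n
  starLine i = embed points (star (2 + n) i)

  ∣starLine∣≡1+n : ∀ i → ∣ starLine i ∣ ≡ suc n
  ∣starLine∣≡1+n i = trans (∣embed∣ points (star (2 + n) i)) (∣star∣≡m (suc n) i)

  ∣starLine∩starLine∣≡1 : ∀ {i j} → i ≢ j → ∣ starLine i ∩ starLine j ∣ ≡ 1
  ∣starLine∩starLine∣≡1 {i} {j} i≢j =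
    trans (∣embed∩embed∣ points (star (2 + n) i) (star (2 + n) j)) (∣star∩star∣≡1 (2 + n) i≢j)

  ∑∣S∩starLine∣≡2∣restrict∣ : ∀ S → ∑[ i < 2 + n ] ∣ S ∩ starLine i ∣ ≡ 2 * ∣ restrict points S ∣
  ∑∣S∩starLine∣≡2∣restrict∣ S =
    trans (sum-cong-≗ (λ i → ∣S∩embed∣ points S (star (2 + n) i)))
          (handshake (2 + n) (restrict points S))

  starLine-no-transversal : parity n ≡ 1ℙ → ∀ S → ¬ (∀ i → ∣ S ∩ starLine i ∣ ≡ 1)
  starLine-no-transversal odd S S∩starLine≡1 = 2*m≢odd ∣ restrict points S ∣ odd (begin
    2 * ∣ restrict points S ∣             ≡⟨ ∑∣S∩starLine∣≡2∣restrict∣ S ⟨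
    ∑[ i < 2 + n ] ∣ S ∩ starLine i ∣     ≡⟨ ∑-const-1 _ S∩starLine≡1 ⟩
    2 + n                                 ∎)
    where open ≡-Reasoning

  ∑∣⁅x⁆∩starLine∣≤2 : ∀ x → ∑[ i < 2 + n ] ∣ ⁅ x ⁆ ∩ starLine i ∣ ≤ 2
  ∑∣⁅x⁆∩starLine∣≤2 x = begin
    ∑[ i < 2 + n ] ∣ ⁅ x ⁆ ∩ starLine i ∣  ≡⟨ ∑∣S∩starLine∣≡2∣restrict∣ ⁅ x ⁆ ⟩
    2 * ∣ restrict points ⁅ x ⁆ ∣          ≤⟨ *-monoʳ-≤ 2 (∣restrict∣≤∣S∣ points ⁅ x ⁆) ⟩
    2 * ∣ ⁅ x ⁆ ∣                          ≡⟨ cong (2 *_) (∣⁅x⁆∣≡1 x) ⟩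
    2                                      ∎
    where open ≤-Reasoning

theorem3 : (k : ℕ) → 1 ≤ k →
    Σ (PurePartialPlane (2 * k + 1)) λ P →
      Saturated P × ((x : Fin (numPoints (2 * k + 1))) → degree P x ≤ 2)
theorem3 k _ = plane , saturated , degree≤2
  where
  open StarPlane (2 * k + 1)
  open FamilyPlane starLine (m+1+n≢0 (2 * k)) ∣starLine∣≡1+n ∣starLine∩starLine∣≡1
  saturated : Saturated plane
  saturated = no-transversal⇒saturated (starLine-no-transversal (parity[2*k+1]≡1ℙ k))
  degree≤2 : ∀ x → degree plane x ≤ 2
  degree≤2 x = subst (_≤ 2) (sym (degree-plane x)) (∑∣⁅x⁆∩starLine∣≤2 x)
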